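{- Let $d\ge1$ and, over the field $\mathbb{Q}(q)$, let $L_{q,d}=D_{q,d}^{ -1}V_{q,d}$, i.e. $(L_{q,d})_{n,l}=(-1)^l\frac{q^{\binom{l+1}{2}-nl}}{(q;q)_n}\begin{bmatrix} n\\ l\end{bmatrix}_q$ for $0\le n,l\le d-1$. Then $U_{q,d}=L_{q,d}Z_{q,d}$.
   Context: Notation: $(q;q)_n=\prod_{k=1}^n(1-q^k)$, $(q;q)_0=1$; $\begin{bmatrix} n\\ k\end{bmatrix}_q=\frac{(q;q)_n}{(q;q)_k(q;q)_{n-k}}$ for $0\le k\le n$ and $0$ otherwise. $Z_{q,d}=(q^{ij})_{0\le i,j\le d-1}$. $U_{q,d}=(u_{n,k})$ with $u_{n,k}=\begin{bmatrix} k\\ n\end{bmatrix}_q$ (zero when $n>k$). $V_{q,d}=(v_{n,k})$ with $v_{n,k}=(-1)^{n-k}q^{\binom{n-k}{2}}\begin{bmatrix} n\\ k\end{bmatrix}_q$ (zero when $k>n$). $D_{q,d}$ is diagonal with entries $(-1)^nq^{\binom n2}(q;q)_n$, $0\le n\le d-1$. All indices range over $0,\dots,d-1$. -}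

module Defs where

open import Data.Nat as ℕ using (ℕ; zero; suc; _∸_; _≤?_; _≟_)
open import Data.Nat.Combinatorics using (_C_)
open import Data.Integer as ℤ using (ℤ; +_; -_)
open import Data.List using (List; []; _∷_; map; replicate; _++_)
open import Data.List.Relation.Unary.All using (All)
open import Relation.Binary.PropositionalEquality using (_≡_)
open import Relation.Nullary using (yes; no)

-- Polynomials ℤ[q]: coefficient lists, lowest degree first.

Poly : Set
Poly = List ℤ

infixl 6 _+ₚ_
infixl 7 _*ₚ_

_+ₚ_ : Poly → Poly → Poly
[]      +ₚ r       = r
(a ∷ p) +ₚ []      = a ∷ p
(a ∷ p) +ₚ (b ∷ r) = (a ℤ.+ b) ∷ (p +ₚ r)

negₚ : Poly → Poly
negₚ = map (λ a → - a)

_*ₚ_ : Poly → Poly → Poly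
[]      *ₚ r = []
(a ∷ p) *ₚ r = map (a ℤ.*_) r +ₚ ((+ 0) ∷ (p *ₚ r))

constₚ : ℤ → Poly
constₚ a = a ∷ []

qpowₚ : ℕ → Poly
qpowₚ m = replicate m (+ 0) ++ (+ 1 ∷ [])

IsZeroₚ : Poly → Set
IsZeroₚ p = All (_≡ + 0) p

_≈ₚ_ : Poly → Poly → Set
p ≈ₚ r = IsZeroₚ (p +ₚ negₚ r)

-- The field ℚ(q) = Frac(ℤ[q]) as quotients num/den, with equality
-- a/b ≃ c/e  iff  a·e = c·b in ℤ[q].  (All denominators occurring
-- below are nonzero polynomials: products of (q;q)_n and powers of q.)

record RatFun : Set where
  constructor _/_
  field
    num : Poly
    den : Poly
open RatFun public

infix 4 _≃_
_≃_ : RatFun → RatFun → Set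
x ≃ y = (num x *ₚ den y) ≈ₚ (num y *ₚ den x)

infixl 6 _+F_
infixl 7 _*F_

_+F_ : RatFun → RatFun → RatFun
x +F y = (num x *ₚ den y +ₚ num y *ₚ den x) / (den x *ₚ den y)

_*F_ : RatFun → RatFun → RatFun
x *F y = (num x *ₚ num y) / (den x *ₚ den y)

-- inverse (used only for nonzero elements)
invF : RatFun → RatFun
invF x = den x / num x

fromPoly : Poly → RatFun
fromPoly p = p / constₚ (+ 1)

0F : RatFun
0F = fromPoly []

qpow : ℕ → RatFun
qpow m = fromPoly (qpowₚ m)

sgn : ℕ → ℤ
sgn zero    = + 1
sgn (suc m) = - sgn m

qpochₚ : ℕ → Poly
qpochₚ zero    = constₚ (+ 1)
qpochₚ (suc n) = qpochₚ n *ₚ (constₚ (+ 1) +ₚ negₚ (qpowₚ (suc n)))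

qpoch : ℕ → RatFun
qpoch n = fromPoly (qpochₚ n)

qbin : ℕ → ℕ → RatFun
qbin n k with k ≤? n
... | yes _ = qpoch n *F invF (qpoch k *F qpoch (n ∸ k))
... | no  _ = 0F

-- Matrices (entries indexed by ℕ; only 0 ≤ n,k ≤ d-1 are used)

Matrix : Set
Matrix = ℕ → ℕ → RatFun

sumF : ℕ → (ℕ → RatFun) → RatFun
sumF zero    f = 0F
sumF (suc d) f = sumF d f +F f d

matMul : ℕ → Matrix → Matrix → Matrix
matMul d A B n k = sumF d (λ m → A n m *F B m k)

Zq : Matrix
Zq i j = qpow (i ℕ.* j)

Uq : Matrix
Uq n k = qbin k n

Vq : Matrix
Vq n k with k ≤? n
... | yes _ = fromPoly (constₚ (sgn (n ∸ k))) *F qpow ((n ∸ k) C 2) *F qbin n k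
... | no  _ = 0F

Dentry : ℕ → RatFun
Dentry n = fromPoly (constₚ (sgn n)) *F qpow (n C 2) *F qpoch n

Dinv : Matrix
Dinv n m with n ≟ m
... | yes _ = invF (Dentry n)
... | no  _ = 0F

Lq : ℕ → Matrix
Lq d = matMul d Dinv Vq

-- Write the entries of D⁻¹V over the common denominator D_n = (-1)^n q^{C(n,2)} (q;q)_n. Then
-- (D⁻¹VZ)_{n,k} = D_n⁻¹ Σ_l (-1)^{n-l} q^{C(n-l,2)} [n l]_q q^{lk}, and by the q-binomial theorem
-- Σ_l (-1)^{n-l} q^{C(n-l,2)} [n l]_q x^l = ∏_{j<n} (x - q^j), here with x = q^k. This product
-- vanishes for k < n (the factor j = k), and for n ≤ k it equals D_n (q;q)_k / (q;q)_{k-n}, so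
-- the entry is [k n]_q. Everything is computed with Gaussian polynomials in ℤ[q] (defined by
-- q-Pascal, so that [n l]_q (q;q)_l (q;q)_{n-l} = (q;q)_n); since ℚ(q) is represented by
-- unreduced fractions, transitivity of their equality is only used through denominators that
-- are non-zero-divisors, which all products of ±1, q^m and (q;q)_m are.

module Submission where

open import Defs
open import Data.Nat as ℕ using (ℕ; zero; suc; _<_; _≤_; _∸_; s≤s; z≤n)
open import Data.Integer as ℤ using (ℤ; +_; -_)
import Data.Integer.Properties as ℤ
import Data.Nat.Properties as ℕ
import Data.Integer.Tactic.RingSolver as ℤ-Solver
open import Data.List using ([]; _∷_; map)
open import Data.List.Relation.Unary.All using ([]; _∷_)
open import Data.Product using (_,_)
open import Algebra.Bundles using (CommutativeRing; Semiring)
open import Level using (0ℓ)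
open import Relation.Binary.PropositionalEquality
open import Relation.Nullary using (yes; no)
open import Data.Nat.Combinatorics using (_C_; nC1≡n; nCk+nC[k+1]≡[n+1]C[k+1])
import Relation.Binary.Reasoning.Setoid
open import Data.Nat.Induction using (<-rec)
open import Data.Sum using (inj₁; inj₂)
open import Data.Empty using (⊥-elim)
open import Data.Maybe as Maybe using (Maybe; just; nothing)
open import Tactic.RingSolver.Core.AlmostCommutativeRing using (AlmostCommutativeRing; fromCommutativeRing)
open import Tactic.RingSolver using (solve-∀)

-- ℤ[q] as a commutative ring

coeff : Poly → ℕ → ℤ
coeff []      i       = + 0
coeff (a ∷ p) zero    = a
coeff (a ∷ p) (suc i) = coeff p i

infix 4 _≋_
record _≋_ (p r : Poly) : Set where
  constructor mk≋
  field coeff-≡ : ∀ i → coeff p i ≡ coeff r i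
open _≋_ public

scale : ℤ → Poly → Poly
scale a = map (a ℤ.*_)

-- conv f g i = Σ_{j ≤ i} f j * g (i - j)
conv : (ℕ → ℤ) → (ℕ → ℤ) → ℕ → ℤ
conv f g zero    = f 0 ℤ.* g 0
conv f g (suc i) = f 0 ℤ.* g (suc i) ℤ.+ conv (λ j → f (suc j)) g i

coeff-+ : ∀ p r i → coeff (p +ₚ r) i ≡ coeff p i ℤ.+ coeff r i
coeff-+ []      r       i       = sym (ℤ.+-identityˡ _)
coeff-+ (a ∷ p) []      zero    = sym (ℤ.+-identityʳ _)
coeff-+ (a ∷ p) []      (suc i) = sym (ℤ.+-identityʳ _)
coeff-+ (a ∷ p) (b ∷ r) zero    = refl
coeff-+ (a ∷ p) (b ∷ r) (suc i) = coeff-+ p r i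

coeff-neg : ∀ p i → coeff (negₚ p) i ≡ - coeff p i
coeff-neg []      i       = refl
coeff-neg (a ∷ p) zero    = refl
coeff-neg (a ∷ p) (suc i) = coeff-neg p i

coeff-scale : ∀ a p i → coeff (scale a p) i ≡ a ℤ.* coeff p i
coeff-scale a []      i       = sym (ℤ.*-zeroʳ a)
coeff-scale a (b ∷ p) zero    = refl
coeff-scale a (b ∷ p) (suc i) = coeff-scale a p i

conv-cong : ∀ {f f′ g g′} → (∀ j → f j ≡ f′ j) → (∀ j → g j ≡ g′ j) →
            ∀ i → conv f g i ≡ conv f′ g′ i
conv-cong f≡ g≡ zero    = cong₂ ℤ._*_ (f≡ 0) (g≡ 0)
conv-cong f≡ g≡ (suc i) =
  cong₂ ℤ._+_ (cong₂ ℤ._*_ (f≡ 0) (g≡ (suc i))) (conv-cong (λ j → f≡ (suc j)) g≡ i)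

conv-zeroˡ : ∀ {f} g → (∀ j → f j ≡ + 0) → ∀ i → conv f g i ≡ + 0
conv-zeroˡ g f≡0 zero    rewrite f≡0 0 = refl
conv-zeroˡ g f≡0 (suc i) rewrite f≡0 0 | conv-zeroˡ g (λ j → f≡0 (suc j)) i = refl

conv-zeroʳ : ∀ f {g} i → (∀ j → j ≤ i → g j ≡ + 0) → conv f g i ≡ + 0
conv-zeroʳ f zero    g≡0 rewrite g≡0 0 z≤n = ℤ.*-zeroʳ (f 0)
conv-zeroʳ f (suc i) g≡0
  rewrite g≡0 (suc i) ℕ.≤-refl | conv-zeroʳ (λ j → f (suc j)) i (λ j j≤i → g≡0 j (ℕ.m≤n⇒m≤1+n j≤i))
  = cong (ℤ._+ + 0) (ℤ.*-zeroʳ (f 0))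

coeff-* : ∀ p r i → coeff (p *ₚ r) i ≡ conv (coeff p) (coeff r) i
coeff-* []      r i       = sym (conv-zeroˡ (coeff r) (λ _ → refl) i)
coeff-* (a ∷ p) r zero    =
  trans (coeff-+ (scale a r) (+ 0 ∷ p *ₚ r) 0) (trans (ℤ.+-identityʳ _) (coeff-scale a r 0))
coeff-* (a ∷ p) r (suc i) =
  trans (coeff-+ (scale a r) (+ 0 ∷ p *ₚ r) (suc i)) (cong₂ ℤ._+_ (coeff-scale a r (suc i)) (coeff-* p r i))

conv-+ˡ : ∀ f f′ g i → conv (λ j → f j ℤ.+ f′ j) g i ≡ conv f g i ℤ.+ conv f′ g i
conv-+ˡ f f′ g zero    = ℤ.*-distribʳ-+ (g 0) (f 0) (f′ 0)
conv-+ˡ f f′ g (suc i) =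
  trans (cong₂ ℤ._+_ (ℤ.*-distribʳ-+ (g (suc i)) (f 0) (f′ 0)) (conv-+ˡ (λ j → f (suc j)) (λ j → f′ (suc j)) g i))
        (interchange (f 0 ℤ.* g (suc i)) (f′ 0 ℤ.* g (suc i)) (conv (λ j → f (suc j)) g i) (conv (λ j → f′ (suc j)) g i))
  where
  interchange : ∀ a b c d → a ℤ.+ b ℤ.+ (c ℤ.+ d) ≡ a ℤ.+ c ℤ.+ (b ℤ.+ d)
  interchange = ℤ-Solver.solve-∀

conv-+ʳ : ∀ f g g′ i → conv f (λ j → g j ℤ.+ g′ j) i ≡ conv f g i ℤ.+ conv f g′ i
conv-+ʳ f g g′ zero    = ℤ.*-distribˡ-+ (f 0) (g 0) (g′ 0)
conv-+ʳ f g g′ (suc i) =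
  trans (cong₂ ℤ._+_ (ℤ.*-distribˡ-+ (f 0) (g (suc i)) (g′ (suc i))) (conv-+ʳ (λ j → f (suc j)) g g′ i))
        (interchange (f 0 ℤ.* g (suc i)) (f 0 ℤ.* g′ (suc i)) (conv (λ j → f (suc j)) g i) (conv (λ j → f (suc j)) g′ i))
  where
  interchange : ∀ a b c d → a ℤ.+ b ℤ.+ (c ℤ.+ d) ≡ a ℤ.+ c ℤ.+ (b ℤ.+ d)
  interchange = ℤ-Solver.solve-∀

conv-scaleˡ : ∀ a f g i → conv (λ j → a ℤ.* f j) g i ≡ a ℤ.* conv f g i
conv-scaleˡ a f g zero    = ℤ.*-assoc a (f 0) (g 0)
conv-scaleˡ a f g (suc i) =
  trans (cong₂ ℤ._+_ (ℤ.*-assoc a (f 0) (g (suc i))) (conv-scaleˡ a (λ j → f (suc j)) g i))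
        (sym (ℤ.*-distribˡ-+ a _ _))

infixr 5 _◂_
_◂_ : ℤ → (ℕ → ℤ) → ℕ → ℤ
(a ◂ g) zero    = a
(a ◂ g) (suc j) = g j

conv-◂ʳ : ∀ a f g i → conv f (a ◂ g) i ≡ a ℤ.* f i ℤ.+ (+ 0 ◂ conv f g) i
conv-◂ʳ a f g zero          = trans (ℤ.*-comm (f 0) a) (sym (ℤ.+-identityʳ _))
conv-◂ʳ a f g (suc zero)    =
  trans (cong (λ z → f 0 ℤ.* g 0 ℤ.+ z) (trans (conv-◂ʳ a (λ j → f (suc j)) g 0) (ℤ.+-identityʳ (a ℤ.* f 1))))
        (ℤ.+-comm (f 0 ℤ.* g 0) (a ℤ.* f 1))
conv-◂ʳ a f g (suc (suc i)) =
  trans (cong (λ z → f 0 ℤ.* g (suc i) ℤ.+ z) (conv-◂ʳ a (λ j → f (suc j)) g (suc i)))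
        (left-comm (f 0 ℤ.* g (suc i)) (a ℤ.* f (suc (suc i))) (conv (λ j → f (suc j)) g i))
  where
  left-comm : ∀ x y z → x ℤ.+ (y ℤ.+ z) ≡ y ℤ.+ (x ℤ.+ z)
  left-comm = ℤ-Solver.solve-∀

1ₚ : Poly
1ₚ = constₚ (+ 1)

conv-1ˡ : ∀ g i → conv (coeff 1ₚ) g i ≡ g i
conv-1ˡ g zero    = ℤ.*-identityˡ (g 0)
conv-1ˡ g (suc i) =
  trans (cong₂ ℤ._+_ (ℤ.*-identityˡ (g (suc i))) (conv-zeroˡ g (λ _ → refl) i)) (ℤ.+-identityʳ _)

≋-refl : ∀ {p} → p ≋ p
≋-refl = mk≋ λ _ → refl

≋-sym : ∀ {p r} → p ≋ r → r ≋ p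
≋-sym p≋r = mk≋ λ i → sym (coeff-≡ p≋r i)

≋-trans : ∀ {p r s} → p ≋ r → r ≋ s → p ≋ s
≋-trans p≋r r≋s = mk≋ λ i → trans (coeff-≡ p≋r i) (coeff-≡ r≋s i)

≋-reflexive : ∀ {p r} → p ≡ r → p ≋ r
≋-reflexive refl = ≋-refl

∷-cong : ∀ {a b p r} → a ≡ b → p ≋ r → a ∷ p ≋ b ∷ r
∷-cong a≡b p≋r = mk≋ λ { zero → a≡b ; (suc i) → coeff-≡ p≋r i }

+-cong : ∀ {p p′ r r′} → p ≋ p′ → r ≋ r′ → p +ₚ r ≋ p′ +ₚ r′
+-cong {p} {p′} {r} {r′} p≋p′ r≋r′ = mk≋ λ i →
  trans (coeff-+ p r i) (trans (cong₂ ℤ._+_ (coeff-≡ p≋p′ i) (coeff-≡ r≋r′ i)) (sym (coeff-+ p′ r′ i)))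

*-cong : ∀ {p p′ r r′} → p ≋ p′ → r ≋ r′ → p *ₚ r ≋ p′ *ₚ r′
*-cong {p} {p′} {r} {r′} p≋p′ r≋r′ = mk≋ λ i →
  trans (coeff-* p r i) (trans (conv-cong (coeff-≡ p≋p′) (coeff-≡ r≋r′) i) (sym (coeff-* p′ r′ i)))

neg-cong : ∀ {p p′} → p ≋ p′ → negₚ p ≋ negₚ p′
neg-cong {p} {p′} p≋p′ = mk≋ λ i →
  trans (coeff-neg p i) (trans (cong -_ (coeff-≡ p≋p′ i)) (sym (coeff-neg p′ i)))

+-congˡ : ∀ p {r r′} → r ≋ r′ → p +ₚ r ≋ p +ₚ r′
+-congˡ p = +-cong (≋-refl {p})

*-congˡ : ∀ p {r r′} → r ≋ r′ → p *ₚ r ≋ p *ₚ r′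
*-congˡ p = *-cong (≋-refl {p})

*-congʳ : ∀ p {r r′} → r ≋ r′ → r *ₚ p ≋ r′ *ₚ p
*-congʳ p r≋r′ = *-cong r≋r′ (≋-refl {p})

+-assoc : ∀ p r s → (p +ₚ r) +ₚ s ≋ p +ₚ (r +ₚ s)
+-assoc p r s = mk≋ λ i → begin
  coeff ((p +ₚ r) +ₚ s) i                 ≡⟨ trans (coeff-+ (p +ₚ r) s i) (cong (ℤ._+ coeff s i) (coeff-+ p r i)) ⟩
  coeff p i ℤ.+ coeff r i ℤ.+ coeff s i   ≡⟨ ℤ.+-assoc (coeff p i) (coeff r i) (coeff s i) ⟩
  coeff p i ℤ.+ (coeff r i ℤ.+ coeff s i) ≡⟨ sym (trans (coeff-+ p (r +ₚ s) i) (cong (λ z → coeff p i ℤ.+ z) (coeff-+ r s i))) ⟩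
  coeff (p +ₚ (r +ₚ s)) i                 ∎
  where open ≡-Reasoning

+-comm : ∀ p r → p +ₚ r ≋ r +ₚ p
+-comm p r = mk≋ λ i →
  trans (coeff-+ p r i) (trans (ℤ.+-comm (coeff p i) (coeff r i)) (sym (coeff-+ r p i)))

+-identityʳ : ∀ p → p +ₚ [] ≋ p
+-identityʳ p = mk≋ λ i → trans (coeff-+ p [] i) (ℤ.+-identityʳ _)

-‿inverseʳ : ∀ p → p +ₚ negₚ p ≋ []
-‿inverseʳ p = mk≋ λ i →
  trans (coeff-+ p (negₚ p) i) (trans (cong (λ z → coeff p i ℤ.+ z) (coeff-neg p i)) (ℤ.+-inverseʳ (coeff p i)))

*-identityˡ : ∀ p → 1ₚ *ₚ p ≋ p
*-identityˡ p = mk≋ λ i → trans (coeff-* 1ₚ p i) (conv-1ˡ (coeff p) i)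

*-zeroʳ : ∀ p → p *ₚ [] ≋ []
*-zeroʳ p = mk≋ λ i → trans (coeff-* p [] i) (conv-zeroʳ (coeff p) i (λ _ _ → refl))

*-distribˡ-+ : ∀ p r s → p *ₚ (r +ₚ s) ≋ p *ₚ r +ₚ p *ₚ s
*-distribˡ-+ p r s = mk≋ λ i → begin
  coeff (p *ₚ (r +ₚ s)) i                                   ≡⟨ trans (coeff-* p (r +ₚ s) i) (conv-cong (λ _ → refl) (coeff-+ r s) i) ⟩
  conv (coeff p) (λ j → coeff r j ℤ.+ coeff s j) i          ≡⟨ conv-+ʳ (coeff p) (coeff r) (coeff s) i ⟩
  conv (coeff p) (coeff r) i ℤ.+ conv (coeff p) (coeff s) i ≡⟨ sym (trans (coeff-+ (p *ₚ r) (p *ₚ s) i) (cong₂ ℤ._+_ (coeff-* p r i) (coeff-* p s i))) ⟩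
  coeff (p *ₚ r +ₚ p *ₚ s) i                                ∎
  where open ≡-Reasoning

*-distribʳ-+ : ∀ p r s → (r +ₚ s) *ₚ p ≋ r *ₚ p +ₚ s *ₚ p
*-distribʳ-+ p r s = mk≋ λ i → begin
  coeff ((r +ₚ s) *ₚ p) i                                   ≡⟨ trans (coeff-* (r +ₚ s) p i) (conv-cong (coeff-+ r s) (λ _ → refl) i) ⟩
  conv (λ j → coeff r j ℤ.+ coeff s j) (coeff p) i          ≡⟨ conv-+ˡ (coeff r) (coeff s) (coeff p) i ⟩
  conv (coeff r) (coeff p) i ℤ.+ conv (coeff s) (coeff p) i ≡⟨ sym (trans (coeff-+ (r *ₚ p) (s *ₚ p) i) (cong₂ ℤ._+_ (coeff-* r p i) (coeff-* s p i))) ⟩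
  coeff (r *ₚ p +ₚ s *ₚ p) i                                ∎
  where open ≡-Reasoning

scale-*ˡ : ∀ a r s → scale a r *ₚ s ≋ scale a (r *ₚ s)
scale-*ˡ a r s = mk≋ λ i →
  trans (coeff-* (scale a r) s i)
    (trans (conv-cong (coeff-scale a r) (λ _ → refl) i)
      (trans (conv-scaleˡ a (coeff r) (coeff s) i)
        (sym (trans (coeff-scale a (r *ₚ s) i) (cong (a ℤ.*_) (coeff-* r s i))))))

shift-*ˡ : ∀ p s → (+ 0 ∷ p) *ₚ s ≋ + 0 ∷ p *ₚ s
shift-*ˡ p s = mk≋ λ
  { zero    → coeff-* (+ 0 ∷ p) s 0
  ; (suc i) → trans (coeff-* (+ 0 ∷ p) s (suc i)) (trans (ℤ.+-identityˡ _) (sym (coeff-* p s i)))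
  }

*-assoc : ∀ p r s → (p *ₚ r) *ₚ s ≋ p *ₚ (r *ₚ s)
*-assoc []      r s = ≋-refl
*-assoc (a ∷ p) r s =
  ≋-trans (*-distribʳ-+ s (scale a r) (+ 0 ∷ p *ₚ r))
          (+-cong (scale-*ˡ a r s) (≋-trans (shift-*ˡ (p *ₚ r) s) (∷-cong refl (*-assoc p r s))))

*-consʳ : ∀ p a r → p *ₚ (a ∷ r) ≋ scale a p +ₚ (+ 0 ∷ p *ₚ r)
*-consʳ p a r = mk≋ λ i → begin
  coeff (p *ₚ (a ∷ r)) i                                    ≡⟨ trans (coeff-* p (a ∷ r) i) (conv-cong (λ _ → refl) coeff-∷ i) ⟩
  conv (coeff p) (a ◂ coeff r) i                            ≡⟨ conv-◂ʳ a (coeff p) (coeff r) i ⟩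
  a ℤ.* coeff p i ℤ.+ (+ 0 ◂ conv (coeff p) (coeff r)) i    ≡⟨ sym (trans (coeff-+ (scale a p) _ i) (cong₂ ℤ._+_ (coeff-scale a p i) (shifted i))) ⟩
  coeff (scale a p +ₚ (+ 0 ∷ p *ₚ r)) i                     ∎
  where
  open ≡-Reasoning
  coeff-∷ : ∀ j → coeff (a ∷ r) j ≡ (a ◂ coeff r) j
  coeff-∷ zero    = refl
  coeff-∷ (suc j) = refl
  shifted : ∀ j → coeff (+ 0 ∷ p *ₚ r) j ≡ (+ 0 ◂ conv (coeff p) (coeff r)) j
  shifted zero    = refl
  shifted (suc j) = coeff-* p r j

*-comm : ∀ p r → p *ₚ r ≋ r *ₚ p
*-comm []      r = ≋-sym (*-zeroʳ r)
*-comm (a ∷ p) r = ≋-trans (+-cong ≋-refl (∷-cong refl (*-comm p r))) (≋-sym (*-consʳ r a p))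

ℤ[q] : CommutativeRing 0ℓ 0ℓ
ℤ[q] = record
  { Carrier = Poly ; _≈_ = _≋_ ; _+_ = _+ₚ_ ; _*_ = _*ₚ_ ; -_ = negₚ ; 0# = [] ; 1# = 1ₚ
  ; isCommutativeRing = record
    { isRing = record
      { +-isAbelianGroup = record
        { isGroup = record
          { isMonoid = record
            { isSemigroup = record
              { isMagma = record
                { isEquivalence = record { refl = ≋-refl ; sym = ≋-sym ; trans = ≋-trans }
                ; ∙-cong = +-cong }
              ; assoc = +-assoc }
            ; identity = (λ _ → ≋-refl) , +-identityʳ }
          ; inverse = (λ p → ≋-trans (+-comm (negₚ p) p) (-‿inverseʳ p)) , -‿inverseʳ
          ; ⁻¹-cong = neg-cong }
        ; comm = +-comm }
      ; *-cong = *-cong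
      ; *-assoc = *-assoc
      ; *-identity = *-identityˡ , (λ p → ≋-trans (*-comm p 1ₚ) (*-identityˡ p))
      ; distrib = *-distribˡ-+ , *-distribʳ-+ }
    ; *-comm = *-comm } }

-- the ring solver needs a sound test for zero on its coefficients, which are polynomials here
isZero? : ∀ p → Maybe ([] ≋ p)
isZero? []        = just ≋-refl
isZero? (+ 0 ∷ p) = Maybe.map (λ []≋p → mk≋ λ { zero → refl ; (suc i) → coeff-≡ []≋p i }) (isZero? p)
isZero? (_ ∷ _)   = nothing

ℤ[q]-solverRing : AlmostCommutativeRing 0ℓ 0ℓ
ℤ[q]-solverRing = fromCommutativeRing ℤ[q] isZero?

module ≋-Reasoning = Relation.Binary.Reasoning.Setoid (CommutativeRing.setoid ℤ[q])

open import Algebra.Definitions.RawSemiring (Semiring.rawSemiring (CommutativeRing.semiring ℤ[q])) using (_^_)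

record NonZeroDivisor (p : Poly) : Set where
  constructor nonZeroDivisor
  field cancel : ∀ r → p *ₚ r ≋ [] → r ≋ []
open NonZeroDivisor public

*-nonZeroDivisor : ∀ {p p′} → NonZeroDivisor p → NonZeroDivisor p′ → NonZeroDivisor (p *ₚ p′)
*-nonZeroDivisor {p} {p′} nzd nzd′ = nonZeroDivisor λ r pp′r≋0 →
  cancel nzd′ r (cancel nzd (p′ *ₚ r) (≋-trans (≋-sym (*-assoc p p′ r)) pp′r≋0))

-- by strong induction: once r vanishes below i, coefficient i of (a ∷ p) *ₚ r is a * coeff r i
nonZeroHead⇒nonZeroDivisor : ∀ a p → a ≢ + 0 → NonZeroDivisor (a ∷ p)
nonZeroHead⇒nonZeroDivisor a p a≢0 = nonZeroDivisor λ r ar≋0 → mk≋ (<-rec _ (vanishes r ar≋0))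
  where
  lowest : ∀ r i → (∀ {j} → j < i → coeff r j ≡ + 0) → coeff ((a ∷ p) *ₚ r) i ≡ a ℤ.* coeff r i
  lowest r zero    _     = coeff-* (a ∷ p) r 0
  lowest r (suc i) below = begin
    coeff ((a ∷ p) *ₚ r) (suc i)                         ≡⟨ coeff-* (a ∷ p) r (suc i) ⟩
    a ℤ.* coeff r (suc i) ℤ.+ conv (coeff p) (coeff r) i ≡⟨ cong (λ z → a ℤ.* coeff r (suc i) ℤ.+ z) (conv-zeroʳ (coeff p) i (λ j j≤i → below (s≤s j≤i))) ⟩
    a ℤ.* coeff r (suc i) ℤ.+ + 0                        ≡⟨ ℤ.+-identityʳ _ ⟩
    a ℤ.* coeff r (suc i)                                ∎
    where open ≡-Reasoning
  vanishes : ∀ r → (a ∷ p) *ₚ r ≋ [] → ∀ i → (∀ {j} → j < i → coeff r j ≡ + 0) → coeff r i ≡ + 0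
  vanishes r ar≋0 i below with ℤ.i*j≡0⇒i≡0∨j≡0 a (trans (sym (lowest r i below)) (coeff-≡ ar≋0 i))
  ... | inj₁ a≡0  = ⊥-elim (a≢0 a≡0)
  ... | inj₂ r≡0 = r≡0

1ₚ-nonZeroDivisor : NonZeroDivisor 1ₚ
1ₚ-nonZeroDivisor = nonZeroHead⇒nonZeroDivisor (+ 1) [] (λ ())

sgn≢0 : ∀ n → sgn n ≢ + 0
sgn≢0 zero    ()
sgn≢0 (suc n) -sgn≡0 = sgn≢0 n (ℤ.neg-injective -sgn≡0)

sgn-nonZeroDivisor : ∀ n → NonZeroDivisor (constₚ (sgn n))
sgn-nonZeroDivisor n = nonZeroHead⇒nonZeroDivisor (sgn n) [] (sgn≢0 n)

qpow-nonZeroDivisor : ∀ m → NonZeroDivisor (qpowₚ m)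
qpow-nonZeroDivisor zero    = 1ₚ-nonZeroDivisor
qpow-nonZeroDivisor (suc m) = nonZeroDivisor λ r qqmr≋0 →
  cancel (qpow-nonZeroDivisor m) r (mk≋ λ i → trans (sym (coeff-≡ (shift-*ˡ (qpowₚ m) r) (suc i))) (coeff-≡ qqmr≋0 (suc i)))

qpoch-nonZeroDivisor : ∀ n → NonZeroDivisor (qpochₚ n)
qpoch-nonZeroDivisor zero    = 1ₚ-nonZeroDivisor
-- the factor 1 - q^{n+1} computes to + 1 ∷ negₚ (qpowₚ n)
qpoch-nonZeroDivisor (suc n) =
  *-nonZeroDivisor (qpoch-nonZeroDivisor n) (nonZeroHead⇒nonZeroDivisor (+ 1) (negₚ (qpowₚ n)) (λ ()))

-- q-powers and Gaussian polynomials

qpow-+ : ∀ m n → qpowₚ (m ℕ.+ n) ≋ qpowₚ m *ₚ qpowₚ n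
qpow-+ zero    n = ≋-sym (*-identityˡ (qpowₚ n))
qpow-+ (suc m) n = ≋-trans (∷-cong refl (qpow-+ m n)) (≋-sym (shift-*ˡ (qpowₚ m) (qpowₚ n)))

1-q^ : ℕ → Poly
1-q^ m = 1ₚ +ₚ negₚ (qpowₚ m)

1-q^-+ : ∀ m n → 1-q^ m +ₚ qpowₚ m *ₚ 1-q^ n ≋ 1-q^ (m ℕ.+ n)
1-q^-+ m n = begin
  1-q^ m +ₚ qpowₚ m *ₚ 1-q^ n               ≈⟨ telescope (qpowₚ m) (qpowₚ n) ⟩
  1ₚ +ₚ negₚ (qpowₚ m *ₚ qpowₚ n)           ≈⟨ +-congˡ 1ₚ (neg-cong (≋-sym (qpow-+ m n))) ⟩
  1-q^ (m ℕ.+ n)                            ∎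
  where
  open ≋-Reasoning
  telescope : ∀ x y → (1ₚ +ₚ negₚ x) +ₚ x *ₚ (1ₚ +ₚ negₚ y) ≋ 1ₚ +ₚ negₚ (x *ₚ y)
  telescope = solve-∀ ℤ[q]-solverRing

gaussianₚ : ℕ → ℕ → Poly
gaussianₚ n       zero    = 1ₚ
gaussianₚ zero    (suc k) = []
gaussianₚ (suc n) (suc k) = gaussianₚ n k +ₚ qpowₚ (suc k) *ₚ gaussianₚ n (suc k)

gaussian-vanishes : ∀ {n k} → n < k → gaussianₚ n k ≋ []
gaussian-vanishes {zero}  {suc k} _           = ≋-refl
gaussian-vanishes {suc n} {suc k} (s≤s n<k) = begin
  gaussianₚ n k +ₚ qpowₚ (suc k) *ₚ gaussianₚ n (suc k) ≈⟨ +-cong (gaussian-vanishes n<k) (*-congˡ (qpowₚ (suc k)) (gaussian-vanishes (ℕ.m≤n⇒m≤1+n n<k))) ⟩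
  [] +ₚ qpowₚ (suc k) *ₚ []                             ≈⟨ *-zeroʳ (qpowₚ (suc k)) ⟩
  []                                                    ∎
  where open ≋-Reasoning

gaussian-qpoch : ∀ {n l} → l ≤ n → gaussianₚ n l *ₚ (qpochₚ l *ₚ qpochₚ (n ∸ l)) ≋ qpochₚ n
gaussian-qpoch {n}     {zero}  _         = ≋-trans (*-identityˡ _) (*-identityˡ _)
gaussian-qpoch {suc n} {suc l} (s≤s l≤n) with ℕ.m≤n⇒m<n∨m≡n l≤n
... | inj₂ refl = begin
  (gaussianₚ n n +ₚ qpowₚ (suc n) *ₚ gaussianₚ n (suc n)) *ₚ ((qpochₚ n *ₚ 1-q^ (suc n)) *ₚ qpochₚ (n ∸ n))
    ≈⟨ *-congʳ _ (+-congˡ (gaussianₚ n n) (≋-trans (*-congˡ (qpowₚ (suc n)) (gaussian-vanishes (ℕ.n<1+n n))) (*-zeroʳ (qpowₚ (suc n))))) ⟩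
  (gaussianₚ n n +ₚ []) *ₚ ((qpochₚ n *ₚ 1-q^ (suc n)) *ₚ qpochₚ (n ∸ n))
    ≈⟨ rearrange (gaussianₚ n n) (qpochₚ n) (qpochₚ (n ∸ n)) (1-q^ (suc n)) ⟩
  (gaussianₚ n n *ₚ (qpochₚ n *ₚ qpochₚ (n ∸ n))) *ₚ 1-q^ (suc n)
    ≈⟨ *-congʳ (1-q^ (suc n)) (gaussian-qpoch (ℕ.≤-refl {n})) ⟩
  qpochₚ n *ₚ 1-q^ (suc n)
    ∎
  where
  open ≋-Reasoning
  rearrange : ∀ g p p′ a → (g +ₚ []) *ₚ ((p *ₚ a) *ₚ p′) ≋ (g *ₚ (p *ₚ p′)) *ₚ a
  rearrange = solve-∀ ℤ[q]-solverRing
... | inj₁ l<n rewrite ℕ.+-∸-assoc 1 l<n = begin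
  (g₁ +ₚ qpowₚ (suc l) *ₚ g₂) *ₚ ((qpochₚ l *ₚ 1-q^ (suc l)) *ₚ (qpochₚ m *ₚ 1-q^ (suc m)))
    ≈⟨ rearrange g₁ g₂ (qpochₚ l) (qpochₚ m) (1-q^ (suc l)) (1-q^ (suc m)) (qpowₚ (suc l)) ⟩
  1-q^ (suc l) *ₚ (g₁ *ₚ (qpochₚ l *ₚ (qpochₚ m *ₚ 1-q^ (suc m))))
    +ₚ (qpowₚ (suc l) *ₚ 1-q^ (suc m)) *ₚ (g₂ *ₚ ((qpochₚ l *ₚ 1-q^ (suc l)) *ₚ qpochₚ m))
    ≈⟨ +-cong (*-congˡ (1-q^ (suc l)) ih₁) (*-congˡ (qpowₚ (suc l) *ₚ 1-q^ (suc m)) (gaussian-qpoch l<n)) ⟩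
  1-q^ (suc l) *ₚ qpochₚ n +ₚ (qpowₚ (suc l) *ₚ 1-q^ (suc m)) *ₚ qpochₚ n
    ≈⟨ factor (1-q^ (suc l)) (qpowₚ (suc l)) (1-q^ (suc m)) (qpochₚ n) ⟩
  qpochₚ n *ₚ (1-q^ (suc l) +ₚ qpowₚ (suc l) *ₚ 1-q^ (suc m))
    ≈⟨ *-congˡ (qpochₚ n) (≋-trans (1-q^-+ (suc l) (suc m)) (≋-reflexive (cong 1-q^ l+m≡n))) ⟩
  qpochₚ n *ₚ 1-q^ (suc n)
    ∎
  where
  open ≋-Reasoning
  m = n ∸ suc l
  g₁ = gaussianₚ n l
  g₂ = gaussianₚ n (suc l)
  l+m≡n : suc l ℕ.+ suc m ≡ suc n
  l+m≡n = trans (ℕ.+-suc (suc l) m) (cong suc (ℕ.m+[n∸m]≡n l<n))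
  ih₁ : g₁ *ₚ (qpochₚ l *ₚ (qpochₚ m *ₚ 1-q^ (suc m))) ≋ qpochₚ n
  ih₁ = subst (λ j → g₁ *ₚ (qpochₚ l *ₚ qpochₚ j) ≋ qpochₚ n) (ℕ.+-∸-assoc 1 l<n) (gaussian-qpoch (ℕ.<⇒≤ l<n))
  rearrange : ∀ g₁ g₂ p p′ a b x →
    (g₁ +ₚ x *ₚ g₂) *ₚ ((p *ₚ a) *ₚ (p′ *ₚ b)) ≋ a *ₚ (g₁ *ₚ (p *ₚ (p′ *ₚ b))) +ₚ (x *ₚ b) *ₚ (g₂ *ₚ ((p *ₚ a) *ₚ p′))
  rearrange = solve-∀ ℤ[q]-solverRing
  factor : ∀ a x b p → a *ₚ p +ₚ (x *ₚ b) *ₚ p ≋ p *ₚ (a +ₚ x *ₚ b)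
  factor = solve-∀ ℤ[q]-solverRing

-- The q-binomial theorem

sumₚ : ℕ → (ℕ → Poly) → Poly
sumₚ zero    f = []
sumₚ (suc N) f = sumₚ N f +ₚ f N

sumₚ-cong : ∀ N {f g} → (∀ l → f l ≋ g l) → sumₚ N f ≋ sumₚ N g
sumₚ-cong zero    f≋g = ≋-refl
sumₚ-cong (suc N) f≋g = +-cong (sumₚ-cong N f≋g) (f≋g N)

sumₚ-zero : ∀ N {f} → (∀ l → f l ≋ []) → sumₚ N f ≋ []
sumₚ-zero zero    f≋0 = ≋-refl
sumₚ-zero (suc N) f≋0 = +-cong (sumₚ-zero N f≋0) (f≋0 N)

sumₚ-shift : ∀ N f → sumₚ (suc N) f ≋ f 0 +ₚ sumₚ N (λ l → f (suc l))
sumₚ-shift zero    f = ≋-sym (+-identityʳ (f 0))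
sumₚ-shift (suc N) f = ≋-trans (+-cong (sumₚ-shift N f) ≋-refl) (+-assoc (f 0) _ (f (suc N)))

sumₚ-+ : ∀ N f g → sumₚ N (λ l → f l +ₚ g l) ≋ sumₚ N f +ₚ sumₚ N g
sumₚ-+ zero    f g = ≋-refl
sumₚ-+ (suc N) f g = ≋-trans (+-cong (sumₚ-+ N f g) ≋-refl) (interchange (sumₚ N f) (sumₚ N g) (f N) (g N))
  where
  interchange : ∀ a b c d → (a +ₚ b) +ₚ (c +ₚ d) ≋ (a +ₚ c) +ₚ (b +ₚ d)
  interchange = solve-∀ ℤ[q]-solverRing

sumₚ-*ˡ : ∀ N a f → sumₚ N (λ l → a *ₚ f l) ≋ a *ₚ sumₚ N f
sumₚ-*ˡ zero    a f = ≋-sym (*-zeroʳ a)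
sumₚ-*ˡ (suc N) a f = ≋-trans (+-cong (sumₚ-*ˡ N a f) ≋-refl) (≋-sym (*-distribˡ-+ a (sumₚ N f) (f N)))

qFallingₚ : Poly → ℕ → Poly
qFallingₚ x zero    = 1ₚ
qFallingₚ x (suc n) = qFallingₚ x n *ₚ (x +ₚ negₚ (qpowₚ n))

qBinomialTermₚ : Poly → ℕ → ℕ → Poly
qBinomialTermₚ x n l = constₚ (sgn (n ∸ l)) *ₚ (qpowₚ ((n ∸ l) C 2) *ₚ (gaussianₚ n l *ₚ x ^ l))

[1+n]C2≡n+nC2 : ∀ n → suc n C 2 ≡ n ℕ.+ n C 2
[1+n]C2≡n+nC2 n = trans (sym (nCk+nC[k+1]≡[n+1]C[k+1] n 1)) (cong (ℕ._+ n C 2) (nC1≡n n))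

qBinomialTerm-suc-zero : ∀ x n → qBinomialTermₚ x (suc n) 0 ≋ negₚ (qpowₚ n) *ₚ qBinomialTermₚ x n 0
qBinomialTerm-suc-zero x n = begin
  negₚ s *ₚ (qpowₚ (suc n C 2) *ₚ y)          ≈⟨ *-congˡ (negₚ s) (*-congʳ y (≋-trans (≋-reflexive (cong qpowₚ ([1+n]C2≡n+nC2 n))) (qpow-+ n (n C 2)))) ⟩
  negₚ s *ₚ ((qpowₚ n *ₚ qpowₚ (n C 2)) *ₚ y) ≈⟨ rearrange s (qpowₚ n) (qpowₚ (n C 2)) y ⟩
  negₚ (qpowₚ n) *ₚ (s *ₚ (qpowₚ (n C 2) *ₚ y)) ∎
  where
  open ≋-Reasoning
  s = constₚ (sgn n)
  y = gaussianₚ (suc n) 0 *ₚ x ^ 0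
  rearrange : ∀ s a b y → negₚ s *ₚ ((a *ₚ b) *ₚ y) ≋ negₚ a *ₚ (s *ₚ (b *ₚ y))
  rearrange = solve-∀ ℤ[q]-solverRing

-- the part of the q-Pascal rule carrying q^{l+1}
qBinomialTerm-pascal : ∀ x n l →
  constₚ (sgn (n ∸ l)) *ₚ (qpowₚ ((n ∸ l) C 2) *ₚ ((qpowₚ (suc l) *ₚ gaussianₚ n (suc l)) *ₚ x ^ suc l))
  ≋ negₚ (qpowₚ n) *ₚ qBinomialTermₚ x n (suc l)
qBinomialTerm-pascal x n l with suc l ℕ.≤? n
... | no  l≮n = ≋-trans lhs≋0 (≋-sym rhs≋0)
  where
  s = constₚ (sgn (n ∸ l))
  s′ = constₚ (sgn (n ∸ suc l))
  y = x ^ suc l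
  g≋0 : gaussianₚ n (suc l) ≋ []
  g≋0 = gaussian-vanishes (ℕ.≰⇒> l≮n)
  lhs≋0 : s *ₚ (qpowₚ ((n ∸ l) C 2) *ₚ ((qpowₚ (suc l) *ₚ gaussianₚ n (suc l)) *ₚ y)) ≋ []
  lhs≋0 = ≋-trans (*-congˡ s (*-congˡ (qpowₚ ((n ∸ l) C 2)) (*-congʳ y (*-congˡ (qpowₚ (suc l)) g≋0))))
                  (zeros s (qpowₚ ((n ∸ l) C 2)) (qpowₚ (suc l)) y)
    where
    zeros : ∀ s a b y → s *ₚ (a *ₚ ((b *ₚ []) *ₚ y)) ≋ []
    zeros = solve-∀ ℤ[q]-solverRing
  rhs≋0 : negₚ (qpowₚ n) *ₚ qBinomialTermₚ x n (suc l) ≋ []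
  rhs≋0 = ≋-trans (*-congˡ (negₚ (qpowₚ n)) (*-congˡ s′ (*-congˡ (qpowₚ ((n ∸ suc l) C 2)) (*-congʳ y g≋0))))
                  (zeros (negₚ (qpowₚ n)) s′ (qpowₚ ((n ∸ suc l) C 2)) y)
    where
    zeros : ∀ c s a y → c *ₚ (s *ₚ (a *ₚ ([] *ₚ y))) ≋ []
    zeros = solve-∀ ℤ[q]-solverRing
... | yes l<n rewrite ℕ.+-∸-assoc 1 l<n = begin
  negₚ s *ₚ (qpowₚ (suc m C 2) *ₚ ((qpowₚ (suc l) *ₚ g) *ₚ y))   ≈⟨ rearrange₁ s (qpowₚ (suc m C 2)) (qpowₚ (suc l)) g y ⟩
  negₚ s *ₚ ((qpowₚ (suc m C 2) *ₚ qpowₚ (suc l)) *ₚ (g *ₚ y))   ≈⟨ *-congˡ (negₚ s) (*-congʳ (g *ₚ y) exponents) ⟩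
  negₚ s *ₚ ((qpowₚ n *ₚ qpowₚ (m C 2)) *ₚ (g *ₚ y))             ≈⟨ rearrange₂ s (qpowₚ n) (qpowₚ (m C 2)) (g *ₚ y) ⟩
  negₚ (qpowₚ n) *ₚ (s *ₚ (qpowₚ (m C 2) *ₚ (g *ₚ y)))           ∎
  where
  open ≋-Reasoning
  m = n ∸ suc l
  s = constₚ (sgn m)
  g = gaussianₚ n (suc l)
  y = x ^ suc l
  exponents : qpowₚ (suc m C 2) *ₚ qpowₚ (suc l) ≋ qpowₚ n *ₚ qpowₚ (m C 2)
  exponents = begin
    qpowₚ (suc m C 2) *ₚ qpowₚ (suc l) ≈⟨ ≋-sym (qpow-+ (suc m C 2) (suc l)) ⟩
    qpowₚ (suc m C 2 ℕ.+ suc l)        ≡⟨ cong qpowₚ (trans (cong (ℕ._+ suc l) ([1+n]C2≡n+nC2 m)) (trans (ℕ.+-comm (m ℕ.+ m C 2) (suc l)) (sym (ℕ.+-assoc (suc l) m (m C 2))))) ⟩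
    qpowₚ ((suc l ℕ.+ m) ℕ.+ m C 2)    ≡⟨ cong (λ e → qpowₚ (e ℕ.+ m C 2)) (ℕ.m+[n∸m]≡n l<n) ⟩
    qpowₚ (n ℕ.+ m C 2)                ≈⟨ qpow-+ n (m C 2) ⟩
    qpowₚ n *ₚ qpowₚ (m C 2)           ∎
  rearrange₁ : ∀ s a b g y → negₚ s *ₚ (a *ₚ ((b *ₚ g) *ₚ y)) ≋ negₚ s *ₚ ((a *ₚ b) *ₚ (g *ₚ y))
  rearrange₁ = solve-∀ ℤ[q]-solverRing
  rearrange₂ : ∀ s a b z → negₚ s *ₚ ((a *ₚ b) *ₚ z) ≋ negₚ a *ₚ (s *ₚ (b *ₚ z))
  rearrange₂ = solve-∀ ℤ[q]-solverRing

qBinomialTerm-suc-suc : ∀ x n l →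
  qBinomialTermₚ x (suc n) (suc l) ≋ x *ₚ qBinomialTermₚ x n l +ₚ negₚ (qpowₚ n) *ₚ qBinomialTermₚ x n (suc l)
qBinomialTerm-suc-suc x n l = begin
  s *ₚ (a *ₚ ((gaussianₚ n l +ₚ qpowₚ (suc l) *ₚ gaussianₚ n (suc l)) *ₚ (x *ₚ x ^ l)))
    ≈⟨ split s a (gaussianₚ n l) (qpowₚ (suc l) *ₚ gaussianₚ n (suc l)) x (x ^ l) ⟩
  x *ₚ qBinomialTermₚ x n l +ₚ s *ₚ (a *ₚ ((qpowₚ (suc l) *ₚ gaussianₚ n (suc l)) *ₚ x ^ suc l))
    ≈⟨ +-congˡ (x *ₚ qBinomialTermₚ x n l) (qBinomialTerm-pascal x n l) ⟩
  x *ₚ qBinomialTermₚ x n l +ₚ negₚ (qpowₚ n) *ₚ qBinomialTermₚ x n (suc l)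
    ∎
  where
  open ≋-Reasoning
  s = constₚ (sgn (n ∸ l))
  a = qpowₚ ((n ∸ l) C 2)
  split : ∀ s a g h x y → s *ₚ (a *ₚ ((g +ₚ h) *ₚ (x *ₚ y))) ≋ x *ₚ (s *ₚ (a *ₚ (g *ₚ y))) +ₚ s *ₚ (a *ₚ (h *ₚ (x *ₚ y)))
  split = solve-∀ ℤ[q]-solverRing

q-binomial-theorem : ∀ x n {N} → n < N → sumₚ N (qBinomialTermₚ x n) ≋ qFallingₚ x n
q-binomial-theorem x zero {suc N} _ = begin
  sumₚ (suc N) (qBinomialTermₚ x 0)                        ≈⟨ sumₚ-shift N (qBinomialTermₚ x 0) ⟩
  qBinomialTermₚ x 0 0 +ₚ sumₚ N (λ l → qBinomialTermₚ x 0 (suc l)) ≈⟨ +-congˡ 1ₚ (sumₚ-zero N (λ l → zeros (constₚ (sgn (0 ∸ suc l))) (qpowₚ ((0 ∸ suc l) C 2)) (x ^ suc l))) ⟩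
  1ₚ +ₚ []                                                 ≈⟨ +-identityʳ 1ₚ ⟩
  1ₚ                                                       ∎
  where
  open ≋-Reasoning
  zeros : ∀ s a y → s *ₚ (a *ₚ ([] *ₚ y)) ≋ []
  zeros = solve-∀ ℤ[q]-solverRing
q-binomial-theorem x (suc n) {suc N} (s≤s n<N) = begin
  sumₚ (suc N) (T (suc n))
    ≈⟨ sumₚ-shift N (T (suc n)) ⟩
  T (suc n) 0 +ₚ sumₚ N (λ l → T (suc n) (suc l))
    ≈⟨ +-cong (qBinomialTerm-suc-zero x n) (sumₚ-cong N (qBinomialTerm-suc-suc x n)) ⟩
  c *ₚ T n 0 +ₚ sumₚ N (λ l → x *ₚ T n l +ₚ c *ₚ T n (suc l))
    ≈⟨ +-congˡ (c *ₚ T n 0) (≋-trans (sumₚ-+ N _ _) (+-cong (sumₚ-*ˡ N x (T n)) (sumₚ-*ˡ N c (λ l → T n (suc l))))) ⟩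
  c *ₚ T n 0 +ₚ (x *ₚ sumₚ N (T n) +ₚ c *ₚ sumₚ N (λ l → T n (suc l)))
    ≈⟨ regroup c x (T n 0) (sumₚ N (T n)) (sumₚ N (λ l → T n (suc l))) ⟩
  x *ₚ sumₚ N (T n) +ₚ c *ₚ (T n 0 +ₚ sumₚ N (λ l → T n (suc l)))
    ≈⟨ +-congˡ (x *ₚ sumₚ N (T n)) (*-congˡ c (≋-sym (sumₚ-shift N (T n)))) ⟩
  x *ₚ sumₚ N (T n) +ₚ c *ₚ sumₚ (suc N) (T n)
    ≈⟨ +-cong (*-congˡ x (q-binomial-theorem x n n<N)) (*-congˡ c (q-binomial-theorem x n (ℕ.m≤n⇒m≤1+n n<N))) ⟩
  x *ₚ qFallingₚ x n +ₚ c *ₚ qFallingₚ x n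
    ≈⟨ factor x c (qFallingₚ x n) ⟩
  qFallingₚ x n *ₚ (x +ₚ c)
    ∎
  where
  open ≋-Reasoning
  T = qBinomialTermₚ x
  c = negₚ (qpowₚ n)
  regroup : ∀ c x t s s′ → c *ₚ t +ₚ (x *ₚ s +ₚ c *ₚ s′) ≋ x *ₚ s +ₚ c *ₚ (t +ₚ s′)
  regroup = solve-∀ ℤ[q]-solverRing
  factor : ∀ x c f → x *ₚ f +ₚ c *ₚ f ≋ f *ₚ (x +ₚ c)
  factor = solve-∀ ℤ[q]-solverRing

qFalling-vanishes : ∀ {k n} → k < n → qFallingₚ (qpowₚ k) n ≋ []
qFalling-vanishes {k} {suc n} (s≤s k≤n) with ℕ.m≤n⇒m<n∨m≡n k≤n
... | inj₁ k<n  = ≋-trans (*-congʳ (qpowₚ k +ₚ negₚ (qpowₚ n)) (qFalling-vanishes k<n)) ≋-refl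
... | inj₂ refl = ≋-trans (*-congˡ (qFallingₚ (qpowₚ k) k) (-‿inverseʳ (qpowₚ k))) (*-zeroʳ (qFallingₚ (qpowₚ k) k))

qFalling-qpoch : ∀ {k n} → n ≤ k →
  qFallingₚ (qpowₚ k) n *ₚ qpochₚ (k ∸ n) ≋ constₚ (sgn n) *ₚ (qpowₚ (n C 2) *ₚ qpochₚ k)
qFalling-qpoch {k} {zero}  _   = ≋-sym (*-identityˡ _)
qFalling-qpoch {k} {suc n} n<k = begin
  (F *ₚ (qpowₚ k +ₚ negₚ (qpowₚ n))) *ₚ qpochₚ m
    ≈⟨ *-congʳ (qpochₚ m) (*-congˡ F (+-cong (≋-trans (≋-reflexive (cong qpowₚ (sym k≡n+1+m))) (qpow-+ n (suc m))) ≋-refl)) ⟩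
  (F *ₚ (qpowₚ n *ₚ qpowₚ (suc m) +ₚ negₚ (qpowₚ n))) *ₚ qpochₚ m
    ≈⟨ rearrange F (qpowₚ n) (qpowₚ (suc m)) (qpochₚ m) ⟩
  negₚ (qpowₚ n) *ₚ (F *ₚ (qpochₚ m *ₚ 1-q^ (suc m)))
    ≈⟨ *-congˡ (negₚ (qpowₚ n)) ih ⟩
  negₚ (qpowₚ n) *ₚ (s *ₚ (qpowₚ (n C 2) *ₚ qpochₚ k))
    ≈⟨ rearrange′ s (qpowₚ n) (qpowₚ (n C 2)) (qpochₚ k) ⟩
  negₚ s *ₚ ((qpowₚ n *ₚ qpowₚ (n C 2)) *ₚ qpochₚ k)
    ≈⟨ *-congˡ (negₚ s) (*-congʳ (qpochₚ k) (≋-trans (≋-sym (qpow-+ n (n C 2))) (≋-reflexive (cong qpowₚ (sym ([1+n]C2≡n+nC2 n)))))) ⟩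
  negₚ s *ₚ (qpowₚ (suc n C 2) *ₚ qpochₚ k)
    ∎
  where
  open ≋-Reasoning
  m = k ∸ suc n
  F = qFallingₚ (qpowₚ k) n
  s = constₚ (sgn n)
  k≡n+1+m : n ℕ.+ suc m ≡ k
  k≡n+1+m = trans (ℕ.+-suc n m) (ℕ.m+[n∸m]≡n n<k)
  ih : F *ₚ (qpochₚ m *ₚ 1-q^ (suc m)) ≋ s *ₚ (qpowₚ (n C 2) *ₚ qpochₚ k)
  ih = subst (λ j → F *ₚ qpochₚ j ≋ s *ₚ (qpowₚ (n C 2) *ₚ qpochₚ k)) (ℕ.+-∸-assoc 1 n<k) (qFalling-qpoch (ℕ.<⇒≤ n<k))
  rearrange : ∀ f a b p → (f *ₚ (a *ₚ b +ₚ negₚ a)) *ₚ p ≋ negₚ a *ₚ (f *ₚ (p *ₚ (1ₚ +ₚ negₚ b)))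
  rearrange = solve-∀ ℤ[q]-solverRing
  rearrange′ : ∀ s a b p → negₚ a *ₚ (s *ₚ (b *ₚ p)) ≋ negₚ s *ₚ ((a *ₚ b) *ₚ p)
  rearrange′ = solve-∀ ℤ[q]-solverRing

-- Fractions

-- _≃_ with the coefficientwise equality of ℤ[q]
infix 4 _≅_
record _≅_ (x y : RatFun) : Set where
  constructor mk≅
  field cross : num x *ₚ den y ≋ num y *ₚ den x

≅-refl : ∀ {x} → x ≅ x
≅-refl = mk≅ ≋-refl

≅-sym : ∀ {x y} → x ≅ y → y ≅ x
≅-sym (mk≅ x≅y) = mk≅ (≋-sym x≅y)

≅-trans : ∀ {x y z} → NonZeroDivisor (den y) → x ≅ y → y ≅ z → x ≅ z
≅-trans {a / b} {c / e} {f / g} nzd (mk≅ a/b≅c/e) (mk≅ c/e≅f/g) = mk≅ (difference≋0⇒≋ (cancel nzd _ (begin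
  e *ₚ (a *ₚ g +ₚ negₚ (f *ₚ b))                 ≈⟨ expand a b e f g ⟩
  (a *ₚ e) *ₚ g +ₚ negₚ ((f *ₚ e) *ₚ b)          ≈⟨ +-cong (*-congʳ g a/b≅c/e) (neg-cong (*-congʳ b (≋-sym c/e≅f/g))) ⟩
  (c *ₚ b) *ₚ g +ₚ negₚ ((c *ₚ g) *ₚ b)          ≈⟨ cancellation b c g ⟩
  []                                             ∎)))
  where
  open ≋-Reasoning
  expand : ∀ a b e f g → e *ₚ (a *ₚ g +ₚ negₚ (f *ₚ b)) ≋ (a *ₚ e) *ₚ g +ₚ negₚ ((f *ₚ e) *ₚ b)
  expand = solve-∀ ℤ[q]-solverRing
  cancellation : ∀ b c g → (c *ₚ b) *ₚ g +ₚ negₚ ((c *ₚ g) *ₚ b) ≋ []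
  cancellation = solve-∀ ℤ[q]-solverRing
  difference≋0⇒≋ : ∀ {p r} → p +ₚ negₚ r ≋ [] → p ≋ r
  difference≋0⇒≋ {p} {r} p-r≋0 = begin
    p                       ≈⟨ add-subtract p r ⟩
    (p +ₚ negₚ r) +ₚ r      ≈⟨ +-cong p-r≋0 ≋-refl ⟩
    r                       ∎
    where
    add-subtract : ∀ p r → p ≋ (p +ₚ negₚ r) +ₚ r
    add-subtract = solve-∀ ℤ[q]-solverRing

+F-cong : ∀ {x x′ y y′} → x ≅ x′ → y ≅ y′ → x +F y ≅ x′ +F y′
+F-cong {a / b} {a′ / b′} {c / e} {c′ / e′} (mk≅ x≅x′) (mk≅ y≅y′) = mk≅ (begin
  (a *ₚ e +ₚ c *ₚ b) *ₚ (b′ *ₚ e′)                    ≈⟨ regroup a b b′ c e e′ ⟩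
  (a *ₚ b′) *ₚ (e *ₚ e′) +ₚ (c *ₚ e′) *ₚ (b *ₚ b′)    ≈⟨ +-cong (*-congʳ (e *ₚ e′) x≅x′) (*-congʳ (b *ₚ b′) y≅y′) ⟩
  (a′ *ₚ b) *ₚ (e *ₚ e′) +ₚ (c′ *ₚ e) *ₚ (b *ₚ b′)    ≈⟨ regroup′ a′ b′ b c′ e′ e ⟩
  (a′ *ₚ e′ +ₚ c′ *ₚ b′) *ₚ (b *ₚ e)                  ∎)
  where
  open ≋-Reasoning
  regroup : ∀ a b b′ c e e′ → (a *ₚ e +ₚ c *ₚ b) *ₚ (b′ *ₚ e′) ≋ (a *ₚ b′) *ₚ (e *ₚ e′) +ₚ (c *ₚ e′) *ₚ (b *ₚ b′)
  regroup = solve-∀ ℤ[q]-solverRing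
  regroup′ : ∀ a b b′ c e e′ → (a *ₚ b′) *ₚ (e′ *ₚ e) +ₚ (c *ₚ e′) *ₚ (b′ *ₚ b) ≋ (a *ₚ e +ₚ c *ₚ b) *ₚ (b′ *ₚ e′)
  regroup′ = solve-∀ ℤ[q]-solverRing

*F-cong : ∀ {x x′ y y′} → x ≅ x′ → y ≅ y′ → x *F y ≅ x′ *F y′
*F-cong {a / b} {a′ / b′} {c / e} {c′ / e′} (mk≅ x≅x′) (mk≅ y≅y′) = mk≅ (begin
  (a *ₚ c) *ₚ (b′ *ₚ e′)   ≈⟨ interchange a c b′ e′ ⟩
  (a *ₚ b′) *ₚ (c *ₚ e′)   ≈⟨ *-cong x≅x′ y≅y′ ⟩
  (a′ *ₚ b) *ₚ (c′ *ₚ e)   ≈⟨ interchange a′ b c′ e ⟩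
  (a′ *ₚ c′) *ₚ (b *ₚ e)   ∎)
  where
  open ≋-Reasoning
  interchange : ∀ a b c e → (a *ₚ b) *ₚ (c *ₚ e) ≋ (a *ₚ c) *ₚ (b *ₚ e)
  interchange = solve-∀ ℤ[q]-solverRing

≅-zeros : ∀ {x y} → num x ≋ [] → num y ≋ [] → x ≅ y
≅-zeros {a / b} {c / e} a≋0 c≋0 = mk≅ (
  ≋-trans (*-congʳ e a≋0) (≋-sym (*-congʳ b c≋0)))

+F-identityʳ : ∀ {x y} → num y ≋ [] → x +F y ≅ x
+F-identityʳ {a / b} {c / e} c≋0 = mk≅ (begin
  (a *ₚ e +ₚ c *ₚ b) *ₚ b   ≈⟨ *-congʳ b (+-congˡ (a *ₚ e) (*-congʳ b c≋0)) ⟩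
  (a *ₚ e +ₚ [] *ₚ b) *ₚ b  ≈⟨ simplify a b e ⟩
  a *ₚ (b *ₚ e)             ∎)
  where
  open ≋-Reasoning
  simplify : ∀ a b e → (a *ₚ e +ₚ [] *ₚ b) *ₚ b ≋ a *ₚ (b *ₚ e)
  simplify = solve-∀ ℤ[q]-solverRing

+F-identityˡ : ∀ {x y} → num x ≋ [] → x +F y ≅ y
+F-identityˡ {a / b} {c / e} a≋0 = mk≅ (begin
  (a *ₚ e +ₚ c *ₚ b) *ₚ e   ≈⟨ *-congʳ e (+-cong (*-congʳ e a≋0) ≋-refl) ⟩
  ([] *ₚ e +ₚ c *ₚ b) *ₚ e  ≈⟨ simplify b c e ⟩
  c *ₚ (b *ₚ e)             ∎)
  where
  open ≋-Reasoning
  simplify : ∀ b c e → ([] *ₚ e +ₚ c *ₚ b) *ₚ e ≋ c *ₚ (b *ₚ e)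
  simplify = solve-∀ ℤ[q]-solverRing

sumF-cong : ∀ N {f g} → (∀ m → f m ≅ g m) → sumF N f ≅ sumF N g
sumF-cong zero    f≅g = ≅-refl
sumF-cong (suc N) f≅g = +F-cong (sumF-cong N f≅g) (f≅g N)

sumF-nonZeroDivisor : ∀ N {f} → (∀ m → NonZeroDivisor (den (f m))) → NonZeroDivisor (den (sumF N f))
sumF-nonZeroDivisor zero    nzd = 1ₚ-nonZeroDivisor
sumF-nonZeroDivisor (suc N) nzd = *-nonZeroDivisor (sumF-nonZeroDivisor N nzd) (nzd N)

sumF-zero : ∀ N {f} → (∀ m → m < N → num (f m) ≋ []) → num (sumF N f) ≋ []
sumF-zero zero    f≋0 = ≋-refl
sumF-zero (suc N) {f} f≋0 =
  +-cong (≋-trans (*-congʳ (den (f N)) (sumF-zero N (λ m m<N → f≋0 m (ℕ.m≤n⇒m≤1+n m<N)))) ≋-refl)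
         (≋-trans (*-congʳ (den (sumF N f)) (f≋0 N ℕ.≤-refl)) ≋-refl)

sumF-single : ∀ N f {n} → n < N → (∀ m → m ≢ n → num (f m) ≋ []) →
              (∀ m → NonZeroDivisor (den (f m))) → sumF N f ≅ f n
sumF-single (suc N) f {n} (s≤s n≤N) f≋0 nzd with ℕ.m≤n⇒m<n∨m≡n n≤N
... | inj₂ refl = +F-identityˡ (sumF-zero N (λ m m<N → f≋0 m (ℕ.<⇒≢ m<N)))
... | inj₁ n<N  = ≅-trans (sumF-nonZeroDivisor N nzd)
                    (+F-identityʳ (f≋0 N (ℕ.>⇒≢ n<N)))
                    (sumF-single N f n<N f≋0 nzd)

sumF-/ : ∀ N t {D} → NonZeroDivisor D → sumF N (λ l → t l / D) ≅ sumₚ N t / D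
sumF-/ zero    t nzd = mk≅ ≋-refl
sumF-/ (suc N) t {D} nzd =
  ≅-trans (*-nonZeroDivisor nzd nzd)
    (+F-cong (sumF-/ N t nzd) (≅-refl {t N / D}))
    (mk≅ (common-denominator (sumₚ N t) (t N) D))
  where
  common-denominator : ∀ s t D → ((s *ₚ D +ₚ t *ₚ D) *ₚ D) ≋ (s +ₚ t) *ₚ (D *ₚ D)
  common-denominator = solve-∀ ℤ[q]-solverRing

Dₚ : ℕ → Poly
Dₚ n = num (Dentry n)

Dₚ-nonZeroDivisor : ∀ n → NonZeroDivisor (Dₚ n)
Dₚ-nonZeroDivisor n =
  *-nonZeroDivisor (*-nonZeroDivisor (sgn-nonZeroDivisor n) (qpow-nonZeroDivisor (n C 2))) (qpoch-nonZeroDivisor n)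

Dinv-diagonal : ∀ n → Dinv n n ≡ invF (Dentry n)
Dinv-diagonal n with n ℕ.≟ n
... | yes _   = refl
... | no  n≢n = ⊥-elim (n≢n refl)

Dinv-offDiagonal : ∀ {n m} → m ≢ n → Dinv n m ≡ 0F
Dinv-offDiagonal {n} {m} m≢n with n ℕ.≟ m
... | yes n≡m = ⊥-elim (m≢n (sym n≡m))
... | no  _   = refl

Dinv-nonZeroDivisor : ∀ n m → NonZeroDivisor (den (Dinv n m))
Dinv-nonZeroDivisor n m with n ℕ.≟ m
... | yes _ = Dₚ-nonZeroDivisor n
... | no  _ = 1ₚ-nonZeroDivisor

qbin-≤ : ∀ {n l} → l ≤ n → qbin n l ≡ qpoch n *F invF (qpoch l *F qpoch (n ∸ l))
qbin-≤ {n} {l} l≤n with l ℕ.≤? n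
... | yes _   = refl
... | no  l≰n = ⊥-elim (l≰n l≤n)

qbin-> : ∀ {n l} → n < l → qbin n l ≡ 0F
qbin-> {n} {l} n<l with l ℕ.≤? n
... | yes l≤n = ⊥-elim (ℕ.<⇒≱ n<l l≤n)
... | no  _   = refl

qbin-nonZeroDivisor : ∀ n l → NonZeroDivisor (den (qbin n l))
qbin-nonZeroDivisor n l with l ℕ.≤? n
... | yes _ = *-nonZeroDivisor 1ₚ-nonZeroDivisor (*-nonZeroDivisor (qpoch-nonZeroDivisor l) (qpoch-nonZeroDivisor (n ∸ l)))
... | no  _ = 1ₚ-nonZeroDivisor

Vq-≤ : ∀ {n l} → l ≤ n →
       Vq n l ≡ fromPoly (constₚ (sgn (n ∸ l))) *F qpow ((n ∸ l) C 2) *F (qpoch n *F invF (qpoch l *F qpoch (n ∸ l)))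
Vq-≤ {n} {l} l≤n with l ℕ.≤? n
... | yes _   = cong (fromPoly (constₚ (sgn (n ∸ l))) *F qpow ((n ∸ l) C 2) *F_) (qbin-≤ l≤n)
... | no  l≰n = ⊥-elim (l≰n l≤n)

Vq-> : ∀ {n l} → n < l → Vq n l ≡ 0F
Vq-> {n} {l} n<l with l ℕ.≤? n
... | yes l≤n = ⊥-elim (ℕ.<⇒≱ n<l l≤n)
... | no  _   = refl

Vq-nonZeroDivisor : ∀ n l → NonZeroDivisor (den (Vq n l))
Vq-nonZeroDivisor n l with l ℕ.≤? n
... | yes _ = *-nonZeroDivisor 1ₚ-nonZeroDivisor (qbin-nonZeroDivisor n l)
... | no  _ = 1ₚ-nonZeroDivisor

Lq-row : ∀ {d n} l → n < d → Lq d n l ≅ Dinv n n *F Vq n l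
Lq-row {d} {n} l n<d = sumF-single d (λ m → Dinv n m *F Vq m l) n<d off-diagonal
  (λ m → *-nonZeroDivisor (Dinv-nonZeroDivisor n m) (Vq-nonZeroDivisor m l))
  where
  off-diagonal : ∀ m → m ≢ n → num (Dinv n m *F Vq m l) ≋ []
  off-diagonal m m≢n rewrite Dinv-offDiagonal m≢n = ≋-refl

qpow-^ : ∀ k l → qpowₚ k ^ l ≋ qpowₚ (l ℕ.* k)
qpow-^ k zero    = ≋-refl
qpow-^ k (suc l) = ≋-trans (*-congˡ (qpowₚ k) (qpow-^ k l)) (≋-sym (qpow-+ k (l ℕ.* k)))

entry-qBinomialTerm : ∀ n k l → (Dinv n n *F Vq n l) *F Zq l k ≅ qBinomialTermₚ (qpowₚ k) n l / Dₚ n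
entry-qBinomialTerm n k l with ℕ.≤-<-connex l n
... | inj₁ l≤n rewrite Dinv-diagonal n | Vq-≤ l≤n = mk≅ (begin
  (((1ₚ *ₚ 1ₚ) *ₚ 1ₚ) *ₚ ((s *ₚ a) *ₚ (qpochₚ n *ₚ (1ₚ *ₚ 1ₚ)))) *ₚ qpowₚ (l ℕ.* k) *ₚ Dₚ n
    ≈⟨ *-congʳ (Dₚ n) (*-congˡ (((1ₚ *ₚ 1ₚ) *ₚ 1ₚ) *ₚ ((s *ₚ a) *ₚ (qpochₚ n *ₚ (1ₚ *ₚ 1ₚ)))) (≋-sym (qpow-^ k l))) ⟩
  (((1ₚ *ₚ 1ₚ) *ₚ 1ₚ) *ₚ ((s *ₚ a) *ₚ (qpochₚ n *ₚ (1ₚ *ₚ 1ₚ)))) *ₚ y *ₚ Dₚ n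
    ≈⟨ collect s a y (qpochₚ n) (Dₚ n) ⟩
  (s *ₚ (a *ₚ y)) *ₚ (qpochₚ n *ₚ Dₚ n)
    ≈⟨ *-congˡ (s *ₚ (a *ₚ y)) (*-congʳ (Dₚ n) (≋-sym (gaussian-qpoch l≤n))) ⟩
  (s *ₚ (a *ₚ y)) *ₚ ((gaussianₚ n l *ₚ (qpochₚ l *ₚ qpochₚ (n ∸ l))) *ₚ Dₚ n)
    ≈⟨ distribute s a y (gaussianₚ n l) (qpochₚ l) (qpochₚ (n ∸ l)) (Dₚ n) ⟩
  (s *ₚ (a *ₚ (gaussianₚ n l *ₚ y))) *ₚ ((Dₚ n *ₚ ((1ₚ *ₚ 1ₚ) *ₚ (1ₚ *ₚ (qpochₚ l *ₚ qpochₚ (n ∸ l))))) *ₚ 1ₚ)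
    ∎)
  where
  open ≋-Reasoning
  s = constₚ (sgn (n ∸ l))
  a = qpowₚ ((n ∸ l) C 2)
  y = qpowₚ k ^ l
  collect : ∀ s a y p D → (((1ₚ *ₚ 1ₚ) *ₚ 1ₚ) *ₚ ((s *ₚ a) *ₚ (p *ₚ (1ₚ *ₚ 1ₚ)))) *ₚ y *ₚ D ≋ (s *ₚ (a *ₚ y)) *ₚ (p *ₚ D)
  collect = solve-∀ ℤ[q]-solverRing
  distribute : ∀ s a y g p p′ D →
    (s *ₚ (a *ₚ y)) *ₚ ((g *ₚ (p *ₚ p′)) *ₚ D) ≋ (s *ₚ (a *ₚ (g *ₚ y))) *ₚ ((D *ₚ ((1ₚ *ₚ 1ₚ) *ₚ (1ₚ *ₚ (p *ₚ p′)))) *ₚ 1ₚ)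
  distribute = solve-∀ ℤ[q]-solverRing
... | inj₂ n<l rewrite Vq-> n<l = ≅-zeros {x = (Dinv n n *F 0F) *F Zq l k}
  (*-congʳ (qpowₚ (l ℕ.* k)) (*-zeroʳ (num (Dinv n n))))
  (≋-trans (*-congˡ s (≋-trans (*-congˡ a (*-congʳ (qpowₚ k ^ l) (gaussian-vanishes n<l))) (*-zeroʳ a))) (*-zeroʳ s))
  where
  s = constₚ (sgn (n ∸ l))
  a = qpowₚ ((n ∸ l) C 2)

qFalling-qbin : ∀ k n → qFallingₚ (qpowₚ k) n / Dₚ n ≅ qbin k n
qFalling-qbin k n with ℕ.≤-<-connex n k
... | inj₁ n≤k rewrite qbin-≤ n≤k = mk≅ (begin
  F *ₚ (1ₚ *ₚ (qpochₚ n *ₚ qpochₚ (k ∸ n)))        ≈⟨ split F (qpochₚ n) (qpochₚ (k ∸ n)) ⟩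
  (F *ₚ qpochₚ (k ∸ n)) *ₚ qpochₚ n                ≈⟨ *-congʳ (qpochₚ n) (qFalling-qpoch n≤k) ⟩
  (s *ₚ (a *ₚ qpochₚ k)) *ₚ qpochₚ n               ≈⟨ merge s a (qpochₚ k) (qpochₚ n) ⟩
  (qpochₚ k *ₚ (1ₚ *ₚ 1ₚ)) *ₚ ((s *ₚ a) *ₚ qpochₚ n) ∎)
  where
  open ≋-Reasoning
  F = qFallingₚ (qpowₚ k) n
  s = constₚ (sgn n)
  a = qpowₚ (n C 2)
  split : ∀ f p p′ → f *ₚ (1ₚ *ₚ (p *ₚ p′)) ≋ (f *ₚ p′) *ₚ p
  split = solve-∀ ℤ[q]-solverRing
  merge : ∀ s a p p′ → (s *ₚ (a *ₚ p)) *ₚ p′ ≋ (p *ₚ (1ₚ *ₚ 1ₚ)) *ₚ ((s *ₚ a) *ₚ p′)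
  merge = solve-∀ ℤ[q]-solverRing
... | inj₂ k<n rewrite qbin-> k<n = mk≅ (*-congʳ 1ₚ (qFalling-vanishes k<n))

LZ-entry : ∀ {d n} k → n < d → matMul d (Lq d) Zq n k ≅ qbin k n
LZ-entry {d} {n} k n<d =
  ≅-trans (sumF-nonZeroDivisor d λ l → *-nonZeroDivisor (*-nonZeroDivisor (Dinv-nonZeroDivisor n n) (Vq-nonZeroDivisor n l)) 1ₚ-nonZeroDivisor)
    (sumF-cong d λ l → *F-cong (Lq-row l n<d) (≅-refl {Zq l k})) (
  ≅-trans (sumF-nonZeroDivisor d λ _ → Dₚ-nonZeroDivisor n)
    (sumF-cong d (entry-qBinomialTerm n k)) (
  ≅-trans (Dₚ-nonZeroDivisor n)
    (sumF-/ d (qBinomialTermₚ (qpowₚ k) n) (Dₚ-nonZeroDivisor n)) (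
  ≅-trans (Dₚ-nonZeroDivisor n)
    (mk≅ (*-congʳ (Dₚ n) (q-binomial-theorem (qpowₚ k) n n<d)))
    (qFalling-qbin k n))))

≋[]⇒IsZero : ∀ {p} → p ≋ [] → IsZeroₚ p
≋[]⇒IsZero {[]}    _   = []
≋[]⇒IsZero {a ∷ p} p≋0 = coeff-≡ p≋0 0 ∷ ≋[]⇒IsZero (mk≋ λ i → coeff-≡ p≋0 (suc i))

≅⇒≃ : ∀ {x y} → x ≅ y → x ≃ y
≅⇒≃ {x} {y} (mk≅ x≅y) =
  ≋[]⇒IsZero (≋-trans (+-cong x≅y (≋-refl {negₚ (num y *ₚ den x)})) (-‿inverseʳ (num y *ₚ den x)))

corollary6 : (d : ℕ) → 1 ≤ d → (n k : ℕ) → n < d → k < d →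
    Uq n k ≃ matMul d (Lq d) Zq n k
corollary6 d _ n k n<d _ = ≅⇒≃ (≅-sym (LZ-entry k n<d))
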